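{- For all DT formulas $A,B$ and every literal $p$, there are cut-free tree-like ${\mathrm{LK}}$ proofs, of size polynomial in the sizes of $A,B$, of the following sequents: (a) $C\to D$, for each $C\in{\mathrm{Tms}}(A)$ and $D\in{\mathrm{Cls}}(A)$; (b)(i) ${\mathrm{Cls}}(ApB)\to D,p$ for each $D\in{\mathrm{Cls}}(A)$; (ii) $p,{\mathrm{Cls}}(ApB)\to D$ for each $D\in{\mathrm{Cls}}(B)$; (iii) ${\mathrm{Cls}}(A)\to D,p$ for each $D\in{\mathrm{Cls}}(ApB)$; (iv) $p,{\mathrm{Cls}}(B)\to D$ for each $D\in{\mathrm{Cls}}(ApB)$; (c)(i) $C\to p,{\mathrm{Tms}}(ApB)$ for each $C\in{\mathrm{Tms}}(A)$; (ii) $p,C\to{\mathrm{Tms}}(ApB)$ for each $C\in{\mathrm{Tms}}(B)$; (iii) $C\to p,{\mathrm{Tms}}(A)$ for each $C\in{\mathrm{Tms}}(ApB)$; (iv) $p,C\to{\mathrm{Tms}}(B)$ for each $C\in{\mathrm{Tms}}(ApB)$.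
   Context: A literal is a propositional variable $x$ or its negation $\overline x$. DT formulas: literals, and $(ApB)$ for DT formulas $A,B$ and literal $p$ ("if $p$ is false then $A$, else $B$"). For a DT formula $A$, the multisets ${\mathrm{Tms}}(A)$ (terms) and ${\mathrm{Cls}}(A)$ (clauses) are: ${\mathrm{Tms}}(p)={\mathrm{Cls}}(p)=\{p\}$; ${\mathrm{Tms}}(BpC)=\{\overline p\land D:D\in{\mathrm{Tms}}(B)\}\cup\{p\land D:D\in{\mathrm{Tms}}(C)\}$; ${\mathrm{Cls}}(BpC)=\{p\lor D:D\in{\mathrm{Cls}}(B)\}\cup\{\overline p\lor D:D\in{\mathrm{Cls}}(C)\}$, with conjunctions and disjunctions associated from right to left. When ${\mathrm{Tms}}(\cdot)$ or ${\mathrm{Cls}}(\cdot)$ appears in a sequent it denotes the cedent consisting of all members of the multiset. ${\mathrm{LK}}$ is the usual sequent calculus for Boolean formulas built from literals by binary $\land,\lor$: initial sequents $p\to p$, $p,\overline p\to$, $\to p,\overline p$; contraction, weakening, cut, and rules: from $A,B,\Gamma\to\Delta$ infer $A\land B,\Gamma\to\Delta$; from $\Gamma\to\Delta,A$ and $\Gamma\to\Delta,B$ infer $\Gamma\to\Delta,A\land B$; from $A,\Gamma\to\Delta$ and $B,\Gamma\to\Delta$ infer $A\lor B,\Gamma\to\Delta$; from $\Gamma\to\Delta,A,B$ infer $\Gamma\to\Delta,A\lor B$. Tree-like: each sequent used at most once as a premise. -}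

module Defs where

open import Data.Nat using (ℕ; zero; suc; _+_; _*_; _^_; _≤_)
open import Data.Bool using (Bool; true; false; not; _∧_)
open import Data.List using (List; []; _∷_; map; _++_)
open import Data.Nat.ListAction using (sum)
open import Data.Product using (Σ; _×_)
open import Data.List.Relation.Binary.Permutation.Propositional using (_↭_)

-- Literals: a propositional variable (indexed by ℕ) with a polarity.
-- pos = true : the variable x;  pos = false : its negation x̄.

record Literal : Set where
  constructor lit
  field
    var : ℕ
    pos : Bool

neg : Literal → Literal
neg (lit x b) = lit x (not b)

infixr 7 _∧'_
infixr 6 _∨'_

data Formula : Set where
  ⟨_⟩   : Literal → Formula
  _∧'_ : Formula → Formula → Formula
  _∨'_ : Formula → Formula → Formula

fsize : Formula → ℕ
fsize ⟨ p ⟩     = 1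
fsize (A ∧' B) = suc (fsize A + fsize B)
fsize (A ∨' B) = suc (fsize A + fsize B)

-- DT formulas: literals, and (A p B) = "if p is false then A else B"

data DT : Set where
  leaf : Literal → DT
  node : DT → Literal → DT → DT

dtsize : DT → ℕ
dtsize (leaf p)     = 1
dtsize (node A p B) = suc (dtsize A + dtsize B)

-- Tms and Cls (multisets represented as lists)
Tms : DT → List Formula
Tms (leaf p)     = ⟨ p ⟩ ∷ []
Tms (node B p C) = map (λ D → ⟨ neg p ⟩ ∧' D) (Tms B) ++ map (λ D → ⟨ p ⟩ ∧' D) (Tms C)

Cls : DT → List Formula
Cls (leaf p)     = ⟨ p ⟩ ∷ []
Cls (node B p C) = map (λ D → ⟨ p ⟩ ∨' D) (Cls B) ++ map (λ D → ⟨ neg p ⟩ ∨' D) (Cls C)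

-- LK (tree-like: derivations are trees by construction).
-- A sequent Γ ⇒ Δ has cedents given as lists; since cedents are multisets,
-- an exchange rule (arbitrary permutation of either cedent) is included.



data LK : List Formula → List Formula → Set where
  ax    : (p : Literal) → LK (⟨ p ⟩ ∷ []) (⟨ p ⟩ ∷ [])
  axL   : (p : Literal) → LK (⟨ p ⟩ ∷ ⟨ neg p ⟩ ∷ []) []
  axR   : (p : Literal) → LK [] (⟨ p ⟩ ∷ ⟨ neg p ⟩ ∷ [])
  exch  : ∀ {Γ Γ' Δ Δ'} → Γ ↭ Γ' → Δ ↭ Δ' → LK Γ Δ → LK Γ' Δ'
  contrL : ∀ {A Γ Δ} → LK (A ∷ A ∷ Γ) Δ → LK (A ∷ Γ) Δ
  contrR : ∀ {A Γ Δ} → LK Γ (A ∷ A ∷ Δ) → LK Γ (A ∷ Δ)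
  weakL : ∀ {A Γ Δ} → LK Γ Δ → LK (A ∷ Γ) Δ
  weakR : ∀ {A Γ Δ} → LK Γ Δ → LK Γ (A ∷ Δ)
  cut   : ∀ {A Γ Δ} → LK Γ (A ∷ Δ) → LK (A ∷ Γ) Δ → LK Γ Δ
  ∧L    : ∀ {A B Γ Δ} → LK (A ∷ B ∷ Γ) Δ → LK (A ∧' B ∷ Γ) Δ
  ∧R    : ∀ {A B Γ Δ} → LK Γ (A ∷ Δ) → LK Γ (B ∷ Δ) → LK Γ (A ∧' B ∷ Δ)
  ∨L    : ∀ {A B Γ Δ} → LK (A ∷ Γ) Δ → LK (B ∷ Γ) Δ → LK (A ∨' B ∷ Γ) Δ
  ∨R    : ∀ {A B Γ Δ} → LK Γ (A ∷ B ∷ Δ) → LK Γ (A ∨' B ∷ Δ)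

cutFree : ∀ {Γ Δ} → LK Γ Δ → Bool
cutFree (ax p)       = true
cutFree (axL p)      = true
cutFree (axR p)      = true
cutFree (exch _ _ π) = cutFree π
cutFree (contrL π)   = cutFree π
cutFree (contrR π)   = cutFree π
cutFree (weakL π)    = cutFree π
cutFree (weakR π)    = cutFree π
cutFree (cut π σ)    = false
cutFree (∧L π)       = cutFree π
cutFree (∧R π σ)     = cutFree π ∧ cutFree σ
cutFree (∨L π σ)     = cutFree π ∧ cutFree σ
cutFree (∨R π)       = cutFree π

-- symbol size of a sequent (+1 for the arrow)
seqsize : List Formula → List Formula → ℕ
seqsize Γ Δ = suc (sum (map fsize Γ) + sum (map fsize Δ))

size : ∀ {Γ Δ} → LK Γ Δ → ℕ
size {Γ} {Δ} (ax p)       = seqsize Γ Δ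
size {Γ} {Δ} (axL p)      = seqsize Γ Δ
size {Γ} {Δ} (axR p)      = seqsize Γ Δ
size {Γ} {Δ} (exch _ _ π) = seqsize Γ Δ + size π
size {Γ} {Δ} (contrL π)   = seqsize Γ Δ + size π
size {Γ} {Δ} (contrR π)   = seqsize Γ Δ + size π
size {Γ} {Δ} (weakL π)    = seqsize Γ Δ + size π
size {Γ} {Δ} (weakR π)    = seqsize Γ Δ + size π
size {Γ} {Δ} (cut π σ)    = seqsize Γ Δ + size π + size σ
size {Γ} {Δ} (∧L π)       = seqsize Γ Δ + size π
size {Γ} {Δ} (∧R π σ)     = seqsize Γ Δ + size π + size σ
size {Γ} {Δ} (∨L π σ)     = seqsize Γ Δ + size π + size σ
size {Γ} {Δ} (∨R π)       = seqsize Γ Δ + size π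

_⊢[_]_ : List Formula → ℕ → List Formula → Set
Γ ⊢[ b ] Δ = Σ (LK Γ Δ) (λ π → (cutFree π ≡ true) × (size π ≤ b))
  where open import Relation.Binary.PropositionalEquality using (_≡_)

-- the polynomial bound  c · (1 + n)^c  (every polynomial is dominated by one of these)
poly : ℕ → ℕ → ℕ
poly c n = c * (suc n ^ c)

-- Since no cut and no contraction is used, no sequent of a proof is larger than its end
-- sequent, so a proof with k inferences of a sequent of size S has size at most k·S.
-- With m = |A| + |B| + 1, every term and clause has size at most 2m and every cedent of the
-- theorem has at most m + 1 formulas, so all end sequents have size O(m²); it remains to find
-- proofs with O(m) inferences. For (a), a term and a clause of one tree share the literal at
-- the node where their branches part, and up to that node they are built in parallel by ∧L
-- and ∨R. Every sequent of (b) and (c) follows by one ∧/∨ rule from an axiom or an identity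
-- D → D, which takes 5·|D| inferences, after weakening in the remaining cedent formulas.

module Submission where

open import Defs
open import Data.Bool using (true; _∧_; T)
open import Data.List using (List; []; _∷_; [_]; _++_; map; length)
open import Data.List.Properties using (length-++; length-map)
open import Data.List.Membership.Propositional using (_∈_)
open import Data.List.Membership.Propositional.Properties
  using (∈-∃++; ∈-map⁺; ∈-map⁻; ∈-++⁺ˡ; ∈-++⁺ʳ; ∈-++⁻)
open import Data.List.Relation.Unary.All as All using (All; []; _∷_)
open import Data.List.Relation.Unary.All.Properties as All using ()
open import Data.List.Relation.Unary.Any using (here)
open import Data.List.Relation.Binary.Permutation.Propositional
open import Data.List.Relation.Binary.Permutation.Propositional.Properties
  using (++-comm; ++⁺ˡ; shift; ↭-length; map⁺)
open import Data.Nat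
open import Data.Nat.Properties
open import Data.Nat.ListAction using (sum)
open import Data.Nat.ListAction.Properties using (sum-↭)
open import Data.Nat.Tactic.RingSolver using (solve-∀)
open import Data.Product using (Σ; ∃; _×_; _,_)
open import Data.Sum using (inj₁; inj₂)
open import Function using (_$_)
open import Relation.Binary.PropositionalEquality using (_≡_; refl; sym; cong; cong₂)

private
  variable
    Γ Γ' Γ₀ Δ Δ' Δ₀ R rest : List Formula
    A B C D X : Formula
    a b c d k u v : ℕ

nodes : LK Γ Δ → ℕ
nodes (ax p)       = 1
nodes (axL p)      = 1
nodes (axR p)      = 1
nodes (exch _ _ π) = suc (nodes π)
nodes (contrL π)   = suc (nodes π)
nodes (contrR π)   = suc (nodes π)
nodes (weakL π)    = suc (nodes π)
nodes (weakR π)    = suc (nodes π)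
nodes (cut π σ)    = suc (nodes π + nodes σ)
nodes (∧L π)       = suc (nodes π)
nodes (∧R π σ)     = suc (nodes π + nodes σ)
nodes (∨L π σ)     = suc (nodes π + nodes σ)
nodes (∨R π)       = suc (nodes π)

data CutContractionFree : LK Γ Δ → Set where
  ax   : ∀ p → CutContractionFree (ax p)
  axL  : ∀ p → CutContractionFree (axL p)
  axR  : ∀ p → CutContractionFree (axR p)
  exch : {ρ : Γ ↭ Γ'} {σ : Δ ↭ Δ'} {π : LK Γ Δ} →
         CutContractionFree π → CutContractionFree (exch ρ σ π)
  weakL : {π : LK Γ Δ} → CutContractionFree π → CutContractionFree (weakL {A} π)
  weakR : {π : LK Γ Δ} → CutContractionFree π → CutContractionFree (weakR {A} π)
  ∧L : {π : LK (A ∷ B ∷ Γ) Δ} → CutContractionFree π → CutContractionFree (∧L π)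
  ∧R : {π : LK Γ (A ∷ Δ)} {σ : LK Γ (B ∷ Δ)} →
       CutContractionFree π → CutContractionFree σ → CutContractionFree (∧R π σ)
  ∨L : {π : LK (A ∷ Γ) Δ} {σ : LK (B ∷ Γ) Δ} →
       CutContractionFree π → CutContractionFree σ → CutContractionFree (∨L π σ)
  ∨R : {π : LK Γ (A ∷ B ∷ Δ)} → CutContractionFree π → CutContractionFree (∨R π)

CutContractionFree⇒cutFree : {π : LK Γ Δ} → CutContractionFree π → cutFree π ≡ true
CutContractionFree⇒cutFree (ax p)    = refl
CutContractionFree⇒cutFree (axL p)   = refl
CutContractionFree⇒cutFree (axR p)   = refl
CutContractionFree⇒cutFree (exch π)  = CutContractionFree⇒cutFree π
CutContractionFree⇒cutFree (weakL π) = CutContractionFree⇒cutFree π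
CutContractionFree⇒cutFree (weakR π) = CutContractionFree⇒cutFree π
CutContractionFree⇒cutFree (∧L π)    = CutContractionFree⇒cutFree π
CutContractionFree⇒cutFree (∧R π σ) =
  cong₂ _∧_ (CutContractionFree⇒cutFree π) (CutContractionFree⇒cutFree σ)
CutContractionFree⇒cutFree (∨L π σ) =
  cong₂ _∧_ (CutContractionFree⇒cutFree π) (CutContractionFree⇒cutFree σ)
CutContractionFree⇒cutFree (∨R π)    = CutContractionFree⇒cutFree π

weight : List Formula → ℕ
weight Γ = sum (map fsize Γ)

weight-↭ : Γ ↭ Γ' → weight Γ ≤ weight Γ'
weight-↭ ρ = ≤-reflexive (sum-↭ (map⁺ fsize ρ))

weight-∷ : ∀ A Γ → weight Γ ≤ weight (A ∷ Γ)
weight-∷ A Γ = m≤n+m (weight Γ) (fsize A)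

weight-head : ∀ A B Γ → fsize A ≤ fsize B → weight (A ∷ Γ) ≤ weight (B ∷ Γ)
weight-head _ _ Γ = +-monoˡ-≤ (weight Γ)

weight-∷∷ : ∀ A B C Γ → fsize A + fsize B ≤ fsize C → weight (A ∷ B ∷ Γ) ≤ weight (C ∷ Γ)
weight-∷∷ A B _ Γ h = ≤-trans (≤-reflexive (sym (+-assoc (fsize A) (fsize B) (weight Γ))))
                              (+-monoˡ-≤ (weight Γ) h)

private
  left≤ : ∀ A B → fsize A ≤ suc (fsize A + fsize B)
  left≤ A B = m≤n⇒m≤1+n (m≤m+n (fsize A) (fsize B))

  right≤ : ∀ A B → fsize B ≤ suc (fsize A + fsize B)
  right≤ A B = m≤n⇒m≤1+n (m≤n+m (fsize B) (fsize A))

  size-bound₁ : ∀ Γ' Δ' (π : LK Γ Δ) → seqsize Γ Δ ≤ seqsize Γ' Δ' →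
                size π ≤ nodes π * seqsize Γ Δ →
                seqsize Γ' Δ' + size π ≤ suc (nodes π) * seqsize Γ' Δ'
  size-bound₁ Γ' Δ' π le h = +-monoʳ-≤ (seqsize Γ' Δ') (≤-trans h (*-monoʳ-≤ (nodes π) le))

  size-bound₂ : ∀ Γ'' Δ'' (π : LK Γ Δ) (σ : LK Γ' Δ') →
                seqsize Γ Δ ≤ seqsize Γ'' Δ'' → seqsize Γ' Δ' ≤ seqsize Γ'' Δ'' →
                size π ≤ nodes π * seqsize Γ Δ → size σ ≤ nodes σ * seqsize Γ' Δ' →
                seqsize Γ'' Δ'' + size π + size σ ≤ suc (nodes π + nodes σ) * seqsize Γ'' Δ''
  size-bound₂ Γ'' Δ'' π σ le₁ le₂ h₁ h₂ = begin
    s + size π + size σ             ≡⟨ +-assoc s _ _ ⟩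
    s + (size π + size σ)           ≤⟨ +-monoʳ-≤ s (+-mono-≤ (≤-trans h₁ (*-monoʳ-≤ (nodes π) le₁))
                                                             (≤-trans h₂ (*-monoʳ-≤ (nodes σ) le₂))) ⟩
    s + (nodes π * s + nodes σ * s) ≡⟨ cong (s +_) (sym (*-distribʳ-+ s (nodes π) (nodes σ))) ⟩
    suc (nodes π + nodes σ) * s     ∎
    where
      open ≤-Reasoning
      s = seqsize Γ'' Δ''

size≤nodes*seqsize : {π : LK Γ Δ} → CutContractionFree π → size π ≤ nodes π * seqsize Γ Δ
size≤nodes*seqsize (ax p)  = m≤m+n _ 0
size≤nodes*seqsize (axL p) = m≤m+n _ 0
size≤nodes*seqsize (axR p) = m≤m+n _ 0
size≤nodes*seqsize {Γ} {Δ} {exch ρ σ π} (exch ok) =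
  size-bound₁ Γ Δ π (s≤s (+-mono-≤ (weight-↭ ρ) (weight-↭ σ))) (size≤nodes*seqsize ok)
size≤nodes*seqsize {A ∷ Γ} {Δ} {weakL π} (weakL ok) =
  size-bound₁ (A ∷ Γ) Δ π (s≤s (+-monoˡ-≤ (weight Δ) (weight-∷ A Γ))) (size≤nodes*seqsize ok)
size≤nodes*seqsize {Γ} {A ∷ Δ} {weakR π} (weakR ok) =
  size-bound₁ Γ (A ∷ Δ) π (s≤s (+-monoʳ-≤ (weight Γ) (weight-∷ A Δ))) (size≤nodes*seqsize ok)
size≤nodes*seqsize {A ∧' B ∷ Γ} {Δ} {∧L π} (∧L ok) =
  size-bound₁ (A ∧' B ∷ Γ) Δ π (s≤s (+-monoˡ-≤ (weight Δ) (weight-∷∷ A B (A ∧' B) Γ (n≤1+n _))))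
    (size≤nodes*seqsize ok)
size≤nodes*seqsize {Γ} {A ∨' B ∷ Δ} {∨R π} (∨R ok) =
  size-bound₁ Γ (A ∨' B ∷ Δ) π (s≤s (+-monoʳ-≤ (weight Γ) (weight-∷∷ A B (A ∨' B) Δ (n≤1+n _))))
    (size≤nodes*seqsize ok)
size≤nodes*seqsize {Γ} {A ∧' B ∷ Δ} {∧R π σ} (∧R ok ok') =
  size-bound₂ Γ (A ∧' B ∷ Δ) π σ
    (s≤s (+-monoʳ-≤ (weight Γ) (weight-head A (A ∧' B) Δ (left≤ A B))))
    (s≤s (+-monoʳ-≤ (weight Γ) (weight-head B (A ∧' B) Δ (right≤ A B))))
    (size≤nodes*seqsize ok) (size≤nodes*seqsize ok')
size≤nodes*seqsize {A ∨' B ∷ Γ} {Δ} {∨L π σ} (∨L ok ok') =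
  size-bound₂ (A ∨' B ∷ Γ) Δ π σ
    (s≤s (+-monoˡ-≤ (weight Δ) (weight-head A (A ∨' B) Γ (left≤ A B))))
    (s≤s (+-monoˡ-≤ (weight Δ) (weight-head B (A ∨' B) Γ (right≤ A B))))
    (size≤nodes*seqsize ok) (size≤nodes*seqsize ok')

-- Inferences are counted in units of u, so that every rule adds a constant number of units
-- and the constants of the derivations of (b) and (c) are computed by normalisation.
infix 4 _⊩[_·_]_

record _⊩[_·_]_ (Γ : List Formula) (c u : ℕ) (Δ : List Formula) : Set where
  constructor derivation
  field
    proof : LK Γ Δ
    cut-contraction-free : CutContractionFree proof
    nodes-≤ : nodes proof ≤ c * u

⊩⇒⊢ : Γ ⊩[ c · u ] Δ → c * u * seqsize Γ Δ ≤ b → Γ ⊢[ b ] Δ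
⊩⇒⊢ (derivation π ok n) h =
  π , CutContractionFree⇒cutFree ok ,
  ≤-trans (size≤nodes*seqsize ok) (≤-trans (*-monoˡ-≤ _ n) h)

⊩-rescale : a * u ≤ b * v → Γ ⊩[ a · u ] Δ → Γ ⊩[ b · v ] Δ
⊩-rescale h (derivation π ok n) = derivation π ok (≤-trans n h)

⊩-mono : a ≤ b → Γ ⊩[ a · u ] Δ → Γ ⊩[ b · u ] Δ
⊩-mono {u = u} h = ⊩-rescale (*-monoˡ-≤ u h)

⊩-relax : Γ ⊩[ a · u ] Δ → {T (a ≤ᵇ b)} → Γ ⊩[ b · u ] Δ
⊩-relax {a = a} {b = b} d {a≤b} = ⊩-mono (≤ᵇ⇒≤ a b a≤b) d

module _ {u : ℕ} .{{_ : NonZero u}} where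

  private
    1≤u : 1 ≤ u
    1≤u = >-nonZero⁻¹ u

    single : 1 ≤ 1 * u
    single = ≤-trans 1≤u (≤-reflexive (sym (*-identityˡ u)))

    unary : ∀ c {k} → k ≤ c * u → suc k ≤ suc c * u
    unary c h = +-mono-≤ 1≤u h

    binary : ∀ c d {k l} → k ≤ c * u → l ≤ d * u → suc (k + l) ≤ suc (c + d) * u
    binary c d h h' =
      +-mono-≤ 1≤u (≤-trans (+-mono-≤ h h') (≤-reflexive (sym (*-distribʳ-+ u c d))))

  ⊩-ax : ∀ p → ⟨ p ⟩ ∷ [] ⊩[ 1 · u ] ⟨ p ⟩ ∷ []
  ⊩-ax p = derivation (ax p) (ax p) single

  ⊩-axL : ∀ p → ⟨ p ⟩ ∷ ⟨ neg p ⟩ ∷ [] ⊩[ 1 · u ] []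
  ⊩-axL p = derivation (axL p) (axL p) single

  ⊩-axR : ∀ p → [] ⊩[ 1 · u ] ⟨ p ⟩ ∷ ⟨ neg p ⟩ ∷ []
  ⊩-axR p = derivation (axR p) (axR p) single

  ⊩-exch : Γ ↭ Γ' → Δ ↭ Δ' → Γ ⊩[ c · u ] Δ → Γ' ⊩[ suc c · u ] Δ'
  ⊩-exch {c = c} ρ σ (derivation π ok n) = derivation (exch ρ σ π) (exch ok) (unary c n)

  ⊩-weakL : Γ ⊩[ c · u ] Δ → A ∷ Γ ⊩[ suc c · u ] Δ
  ⊩-weakL {c = c} (derivation π ok n) = derivation (weakL π) (weakL ok) (unary c n)

  ⊩-weakR : Γ ⊩[ c · u ] Δ → Γ ⊩[ suc c · u ] A ∷ Δ
  ⊩-weakR {c = c} (derivation π ok n) = derivation (weakR π) (weakR ok) (unary c n)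

  ⊩-∧L : A ∷ B ∷ Γ ⊩[ c · u ] Δ → A ∧' B ∷ Γ ⊩[ suc c · u ] Δ
  ⊩-∧L {c = c} (derivation π ok n) = derivation (∧L π) (∧L ok) (unary c n)

  ⊩-∨R : Γ ⊩[ c · u ] A ∷ B ∷ Δ → Γ ⊩[ suc c · u ] A ∨' B ∷ Δ
  ⊩-∨R {c = c} (derivation π ok n) = derivation (∨R π) (∨R ok) (unary c n)

  ⊩-∧R : Γ ⊩[ c · u ] A ∷ Δ → Γ ⊩[ d · u ] B ∷ Δ → Γ ⊩[ suc (c + d) · u ] A ∧' B ∷ Δ
  ⊩-∧R {c = c} {d = d} (derivation π ok n) (derivation σ ok' n') =
    derivation (∧R π σ) (∧R ok ok') (binary c d n n')

  ⊩-∨L : A ∷ Γ ⊩[ c · u ] Δ → B ∷ Γ ⊩[ d · u ] Δ → A ∨' B ∷ Γ ⊩[ suc (c + d) · u ] Δ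
  ⊩-∨L {c = c} {d = d} (derivation π ok n) (derivation σ ok' n') =
    derivation (∨L π σ) (∨L ok ok') (binary c d n n')

  ⊩-swapL : A ∷ B ∷ Γ ⊩[ c · u ] Δ → B ∷ A ∷ Γ ⊩[ suc c · u ] Δ
  ⊩-swapL = ⊩-exch (↭-swap _ _ ↭-refl) ↭-refl

  ⊩-swapR : Γ ⊩[ c · u ] A ∷ B ∷ Δ → Γ ⊩[ suc c · u ] B ∷ A ∷ Δ
  ⊩-swapR = ⊩-exch ↭-refl (↭-swap _ _ ↭-refl)

private
  weakenL⋆ : ∀ R → Γ ⊩[ k · 1 ] Δ → R ++ Γ ⊩[ length R + k · 1 ] Δ
  weakenL⋆ []      d = d
  weakenL⋆ (_ ∷ R) d = ⊩-weakL (weakenL⋆ R d)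

  weakenR⋆ : ∀ R → Γ ⊩[ k · 1 ] Δ → Γ ⊩[ length R + k · 1 ] R ++ Δ
  weakenR⋆ []      d = d
  weakenR⋆ (_ ∷ R) d = ⊩-weakR (weakenR⋆ R d)

∈⇒↭-rest : X ∈ Γ → ∃ λ rest → X ∷ rest ↭ Γ
∈⇒↭-rest x∈Γ with ys , zs , refl ← ∈-∃++ x∈Γ = ys ++ zs , ↭-sym (shift _ ys zs)

↭-move : ∀ Γ₀ → X ∷ rest ↭ Γ → rest ++ X ∷ Γ₀ ↭ Γ₀ ++ Γ
↭-move {X} {rest} {Γ} Γ₀ ρ = begin
  rest ++ X ∷ Γ₀   ↭⟨ ++-comm rest (X ∷ Γ₀) ⟩
  X ∷ Γ₀ ++ rest   ↭⟨ ↭-sym (shift X Γ₀ rest) ⟩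
  Γ₀ ++ X ∷ rest   ↭⟨ ++⁺ˡ Γ₀ ρ ⟩
  Γ₀ ++ Γ          ∎
  where open PermutationReasoning

module _ {u : ℕ} .{{_ : NonZero u}} where

  private
    weakening-cost : ∀ (R : List Formula) c → length R ≤ u → (length R + c * u) * 1 ≤ suc c * u
    weakening-cost R c h = ≤-trans (≤-reflexive (*-identityʳ _)) (+-monoˡ-≤ (c * u) h)

    to-unit-1 : Γ ⊩[ c · u ] Δ → Γ ⊩[ c * u · 1 ] Δ
    to-unit-1 {c = c} = ⊩-rescale (≤-reflexive (sym (*-identityʳ (c * u))))

    rest-length : X ∷ rest ↭ Γ → length Γ ≤ u → length rest ≤ u
    rest-length ρ h = ≤-trans (n≤1+n _) (≤-trans (≤-reflexive (↭-length ρ)) h)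

  ⊩-weakenL : ∀ R → length R ≤ u → R ++ Γ ↭ Γ' → Γ ⊩[ c · u ] Δ → Γ' ⊩[ 2 + c · u ] Δ
  ⊩-weakenL {c = c} R h ρ d =
    ⊩-exch ρ ↭-refl (⊩-rescale (weakening-cost R c h) (weakenL⋆ R (to-unit-1 d)))

  ⊩-weakenR : ∀ R → length R ≤ u → R ++ Δ ↭ Δ' → Γ ⊩[ c · u ] Δ → Γ ⊩[ 2 + c · u ] Δ'
  ⊩-weakenR {c = c} R h ρ d =
    ⊩-exch ↭-refl ρ (⊩-rescale (weakening-cost R c h) (weakenR⋆ R (to-unit-1 d)))

  ⊩-extendL : ∀ R → length R ≤ u → Γ ⊩[ c · u ] Δ → Γ ++ R ⊩[ 2 + c · u ] Δ
  ⊩-extendL {Γ} R h = ⊩-weakenL R h (++-comm R Γ)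

  ⊩-extendR : ∀ R → length R ≤ u → Γ ⊩[ c · u ] Δ → Γ ⊩[ 2 + c · u ] Δ ++ R
  ⊩-extendR {Δ = Δ} R h = ⊩-weakenR R h (++-comm R Δ)

  ⊩-pickL : X ∈ Γ → length Γ ≤ u → X ∷ Γ₀ ⊩[ c · u ] Δ → Γ₀ ++ Γ ⊩[ 2 + c · u ] Δ
  ⊩-pickL {Γ₀ = Γ₀} x∈Γ h d with rest , ρ ← ∈⇒↭-rest x∈Γ =
    ⊩-weakenL rest (rest-length ρ h) (↭-move Γ₀ ρ) d

  ⊩-pickR : X ∈ Δ → length Δ ≤ u → Γ ⊩[ c · u ] X ∷ Δ₀ → Γ ⊩[ 2 + c · u ] Δ₀ ++ Δ
  ⊩-pickR {Δ₀ = Δ₀} x∈Δ h d with rest , ρ ← ∈⇒↭-rest x∈Δ =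
    ⊩-weakenR rest (rest-length ρ h) (↭-move Δ₀ ρ) d

private
  five-per-connective : ∀ a b → 4 + 5 * a + (1 + 5 * b) ≡ 5 * suc (a + b)
  five-per-connective = solve-∀

⊩-id-fsize : ∀ D → D ∷ [] ⊩[ 5 * fsize D · 1 ] D ∷ []
⊩-id-fsize ⟨ p ⟩    = ⊩-mono (s≤s z≤n) (⊩-ax p)
⊩-id-fsize (A ∧' B) = ⊩-mono (≤-reflexive (five-per-connective (fsize A) (fsize B)))
  (⊩-∧L (⊩-∧R (⊩-swapL (⊩-weakL (⊩-id-fsize A))) (⊩-weakL (⊩-id-fsize B))))
⊩-id-fsize (A ∨' B) = ⊩-mono (≤-reflexive (five-per-connective (fsize A) (fsize B)))
  (⊩-∨R (⊩-∨L (⊩-swapR (⊩-weakR (⊩-id-fsize A))) (⊩-weakR (⊩-id-fsize B))))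

⊩-id : fsize D ≤ 2 * u → D ∷ [] ⊩[ 10 · u ] D ∷ []
⊩-id {D} {u} h = ⊩-rescale cost (⊩-id-fsize D)
  where
    cost : 5 * fsize D * 1 ≤ 10 * u
    cost = ≤-trans (≤-reflexive (*-identityʳ _))
                   (≤-trans (*-monoʳ-≤ 5 h) (≤-reflexive (sym (*-assoc 5 2 u))))

data TmsView (E : DT) (q : Literal) (F : DT) : Formula → Set where
  left  : C ∈ Tms E → TmsView E q F (⟨ neg q ⟩ ∧' C)
  right : C ∈ Tms F → TmsView E q F (⟨ q ⟩ ∧' C)

data ClsView (E : DT) (q : Literal) (F : DT) : Formula → Set where
  left  : D ∈ Cls E → ClsView E q F (⟨ q ⟩ ∨' D)
  right : D ∈ Cls F → ClsView E q F (⟨ neg q ⟩ ∨' D)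

Tms-view : ∀ E q F → C ∈ Tms (node E q F) → TmsView E q F C
Tms-view E q F C∈ with ∈-++⁻ (map (⟨ neg q ⟩ ∧'_) (Tms E)) C∈
... | inj₁ C∈ˡ with _ , C'∈ , refl ← ∈-map⁻ _ C∈ˡ = left C'∈
... | inj₂ C∈ʳ with _ , C'∈ , refl ← ∈-map⁻ _ C∈ʳ = right C'∈

Cls-view : ∀ E q F → D ∈ Cls (node E q F) → ClsView E q F D
Cls-view E q F D∈ with ∈-++⁻ (map (⟨ q ⟩ ∨'_) (Cls E)) D∈
... | inj₁ D∈ˡ with _ , D'∈ , refl ← ∈-map⁻ _ D∈ˡ = left D'∈
... | inj₂ D∈ʳ with _ , D'∈ , refl ← ∈-map⁻ _ D∈ʳ = right D'∈

∈-Tms⁺ˡ : ∀ E q F → C ∈ Tms E → ⟨ neg q ⟩ ∧' C ∈ Tms (node E q F)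
∈-Tms⁺ˡ _ q _ C∈ = ∈-++⁺ˡ (∈-map⁺ (⟨ neg q ⟩ ∧'_) C∈)

∈-Tms⁺ʳ : ∀ E q F → C ∈ Tms F → ⟨ q ⟩ ∧' C ∈ Tms (node E q F)
∈-Tms⁺ʳ E q _ C∈ = ∈-++⁺ʳ (map (⟨ neg q ⟩ ∧'_) (Tms E)) (∈-map⁺ (⟨ q ⟩ ∧'_) C∈)

∈-Cls⁺ˡ : ∀ E q F → D ∈ Cls E → ⟨ q ⟩ ∨' D ∈ Cls (node E q F)
∈-Cls⁺ˡ _ q _ D∈ = ∈-++⁺ˡ (∈-map⁺ (⟨ q ⟩ ∨'_) D∈)

∈-Cls⁺ʳ : ∀ E q F → D ∈ Cls F → ⟨ neg q ⟩ ∨' D ∈ Cls (node E q F)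
∈-Cls⁺ʳ E q _ D∈ = ∈-++⁺ʳ (map (⟨ q ⟩ ∨'_) (Cls E)) (∈-map⁺ (⟨ neg q ⟩ ∨'_) D∈)

private
  4+6*m≤6*[1+n] : ∀ {m n} → m ≤ n → 4 + 6 * m ≤ 6 * suc n
  4+6*m≤6*[1+n] {n = n} h =
    ≤-trans (+-mono-≤ (m≤m+n 4 2) (*-monoʳ-≤ 6 h)) (≤-reflexive (sym (*-suc 6 n)))

  ⊩-literal-on-both-sides : ∀ q → ⟨ q ⟩ ∷ C ∷ [] ⊩[ 4 · 1 ] ⟨ q ⟩ ∷ D ∷ []
  ⊩-literal-on-both-sides q =
    ⊩-exch (↭-swap _ _ ↭-refl) (↭-swap _ _ ↭-refl) (⊩-weakL (⊩-weakR (⊩-ax q)))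

Tms⊩Cls : ∀ X → C ∈ Tms X → D ∈ Cls X → C ∷ [] ⊩[ 6 * dtsize X · 1 ] D ∷ []
Tms⊩Cls (leaf p) (here refl) (here refl) = ⊩-mono (s≤s z≤n) (⊩-ax p)
Tms⊩Cls (node E q F) C∈ D∈ with Tms-view E q F C∈ | Cls-view E q F D∈
... | left C∈E  | left D∈E  =
  ⊩-mono (4+6*m≤6*[1+n] (m≤m+n (dtsize E) (dtsize F)))
    (⊩-∧L (⊩-∨R (⊩-weakL (⊩-weakR (Tms⊩Cls E C∈E D∈E)))))
... | right C∈F | right D∈F =
  ⊩-mono (4+6*m≤6*[1+n] (m≤n+m (dtsize F) (dtsize E)))
    (⊩-∧L (⊩-∨R (⊩-weakL (⊩-weakR (Tms⊩Cls F C∈F D∈F)))))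
... | left _    | right _   =
  ⊩-mono (*-monoʳ-≤ 6 (s≤s z≤n)) (⊩-∧L (⊩-∨R (⊩-literal-on-both-sides (neg q))))
... | right _   | left _    =
  ⊩-mono (*-monoʳ-≤ 6 (s≤s z≤n)) (⊩-∧L (⊩-∨R (⊩-literal-on-both-sides q)))

record Bounded (m : ℕ) (Γ : List Formula) : Set where
  field
    length-≤ : length Γ ≤ m
    fsize-≤  : All (λ F → fsize F ≤ 2 * m) Γ

  fsize-∈ : X ∈ Γ → fsize X ≤ 2 * m
  fsize-∈ = All.lookup fsize-≤

open Bounded

Bounded-singleton : 1 ≤ u → fsize X ≤ 2 * u → Bounded u [ X ]
Bounded-singleton h hX = record { length-≤ = h ; fsize-≤ = hX ∷ [] }

weight≤length* : All (λ F → fsize F ≤ k) Γ → weight Γ ≤ length Γ * k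
weight≤length* []       = z≤n
weight≤length* (h ∷ hs) = +-mono-≤ h (weight≤length* hs)

Bounded⇒weight≤ : Bounded u Γ → weight Γ ≤ u * (2 * u)
Bounded⇒weight≤ {u} b = ≤-trans (weight≤length* (fsize-≤ b)) (*-monoˡ-≤ (2 * u) (length-≤ b))

private
  length-graft : ∀ (f g : Formula → Formula) Γ Δ →
                 length (map f Γ ++ map g Δ) ≤ suc (length Γ + length Δ)
  length-graft f g Γ Δ = begin
    length (map f Γ ++ map g Δ)        ≡⟨ length-++ (map f Γ) ⟩
    length (map f Γ) + length (map g Δ) ≡⟨ cong₂ _+_ (length-map f Γ) (length-map g Δ) ⟩
    length Γ + length Δ                <⟨ n<1+n _ ⟩
    suc (length Γ + length Δ)          ∎
    where open ≤-Reasoning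

  fsize-graft : ∀ x y (f g : Formula → Formula) →
                (∀ D → fsize (f D) ≡ 2 + fsize D) → (∀ D → fsize (g D) ≡ 2 + fsize D) →
                All (λ D → fsize D ≤ 2 * x) Γ → All (λ D → fsize D ≤ 2 * y) Δ →
                All (λ D → fsize D ≤ 2 * suc (x + y)) (map f Γ ++ map g Δ)
  fsize-graft x y f g hf hg bΓ bΔ =
    All.++⁺ (All.map⁺ (All.map (two-more hf (m≤m+n x y)) bΓ))
            (All.map⁺ (All.map (two-more hg (m≤n+m y x)) bΔ))
    where
      two-more : ∀ {h : Formula → Formula} {z} → (∀ D → fsize (h D) ≡ 2 + fsize D) → z ≤ x + y →
                 ∀ {D} → fsize D ≤ 2 * z → fsize (h D) ≤ 2 * suc (x + y)
      two-more {h} {z} hh z≤ {D} hD = begin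
        fsize (h D)       ≡⟨ hh D ⟩
        2 + fsize D       ≤⟨ +-monoʳ-≤ 2 (≤-trans hD (*-monoʳ-≤ 2 z≤)) ⟩
        2 + 2 * (x + y)   ≡⟨ sym (*-suc 2 (x + y)) ⟩
        2 * suc (x + y)   ∎
        where open ≤-Reasoning

Tms-bounded : ∀ X → Bounded (dtsize X) (Tms X)
Tms-bounded (leaf p) = Bounded-singleton ≤-refl (s≤s z≤n)
Tms-bounded (node E q F) = record
  { length-≤ = ≤-trans (length-graft _ _ (Tms E) (Tms F))
                       (s≤s (+-mono-≤ (length-≤ (Tms-bounded E)) (length-≤ (Tms-bounded F))))
  ; fsize-≤  = fsize-graft (dtsize E) (dtsize F) _ _ (λ _ → refl) (λ _ → refl)
                 (fsize-≤ (Tms-bounded E)) (fsize-≤ (Tms-bounded F))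
  }

Cls-bounded : ∀ X → Bounded (dtsize X) (Cls X)
Cls-bounded (leaf p) = Bounded-singleton ≤-refl (s≤s z≤n)
Cls-bounded (node E q F) = record
  { length-≤ = ≤-trans (length-graft _ _ (Cls E) (Cls F))
                       (s≤s (+-mono-≤ (length-≤ (Cls-bounded E)) (length-≤ (Cls-bounded F))))
  ; fsize-≤  = fsize-graft (dtsize E) (dtsize F) _ _ (λ _ → refl) (λ _ → refl)
                 (fsize-≤ (Cls-bounded E)) (fsize-≤ (Cls-bounded F))
  }

Bounded-mono : a ≤ b → Bounded a Γ → Bounded b Γ
Bounded-mono h bΓ = record
  { length-≤ = ≤-trans (length-≤ bΓ) h
  ; fsize-≤  = All.map (λ hF → ≤-trans hF (*-monoʳ-≤ 2 h)) (fsize-≤ bΓ)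
  }

private
  -- With m = n + 1 and cedent weights W = (m + 1)·2m: 2W + 1 = (2m + 1)² ≤ (3m)².
  -- Stated for every c ≥ 180 so that poly is never unfolded at a numeral.
  budget : ∀ c n → 180 ≤ c →
           20 * suc n * suc (suc (suc n) * (2 * suc n) + suc (suc n) * (2 * suc n)) ≤ poly c n
  budget c n 180≤c = begin
    20 * suc n * suc (suc (suc n) * (2 * suc n) + suc (suc n) * (2 * suc n))
      ≡⟨ cong (20 * suc n *_) (square n) ⟩
    20 * suc n * (suc (2 * suc n) * suc (2 * suc n))
      ≤⟨ *-monoʳ-≤ (20 * suc n) (*-mono-≤ (2m+1≤3m n) (2m+1≤3m n)) ⟩
    20 * suc n * (3 * suc n * (3 * suc n))
      ≡⟨ cube n ⟩
    180 * suc n ^ 3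
      ≤⟨ *-mono-≤ 180≤c (^-monoʳ-≤ (suc n) (≤-trans (m≤m+n 3 177) 180≤c)) ⟩
    poly c n ∎
    where
      open ≤-Reasoning
      square : ∀ x → suc (suc (suc x) * (2 * suc x) + suc (suc x) * (2 * suc x)) ≡
                     suc (2 * suc x) * suc (2 * suc x)
      square = solve-∀
      cube : ∀ x → 20 * suc x * (3 * suc x * (3 * suc x)) ≡ 180 * (suc x * (suc x * (suc x * 1)))
      cube = solve-∀
      2m+1≤3m : ∀ x → suc (2 * suc x) ≤ 3 * suc x
      2m+1≤3m x = +-monoˡ-≤ (2 * suc x) (s≤s z≤n)

-- A record rather than an inequality, so that u is compared as an index and never unfolded.
record Fits (u : ℕ) (Γ : List Formula) : Set where
  field
    weight-≤ : weight Γ ≤ suc u * (2 * u)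

open Fits

fits : Bounded u Γ → Fits u Γ
fits {u} bΓ = record { weight-≤ = ≤-trans (Bounded⇒weight≤ bΓ) (m≤n+m _ (2 * u)) }

fits-∷ : fsize X ≤ 2 * u → Bounded u Γ → Fits u (X ∷ Γ)
fits-∷ hX bΓ = record { weight-≤ = +-mono-≤ hX (Bounded⇒weight≤ bΓ) }

⊩⇒⊢-poly : ∀ n → Γ ⊩[ c · suc n ] Δ → {T (c ≤ᵇ 20)} → Fits (suc n) Γ → Fits (suc n) Δ →
           Γ ⊢[ poly 180 n ] Δ
⊩⇒⊢-poly n d {c≤20} hΓ hΔ = ⊩⇒⊢ (⊩-relax d {c≤20})
  (≤-trans (*-monoʳ-≤ (20 * suc n) (s≤s (+-mono-≤ (weight-≤ hΓ) (weight-≤ hΔ))))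
           (budget 180 n ≤-refl))

module _ (A B : DT) (p : Literal) where

  private
    m  = suc (dtsize A + dtsize B)
    AB = node A p B
    P  = ⟨ p ⟩
    N  = ⟨ neg p ⟩

    A≤m : dtsize A ≤ m
    A≤m = m≤n⇒m≤1+n (m≤m+n (dtsize A) (dtsize B))

    B≤m : dtsize B ≤ m
    B≤m = m≤n⇒m≤1+n (m≤n+m (dtsize B) (dtsize A))

    TmsA = Bounded-mono A≤m (Tms-bounded A)
    TmsB = Bounded-mono B≤m (Tms-bounded B)
    TmsAB = Tms-bounded AB
    ClsA = Bounded-mono A≤m (Cls-bounded A)
    ClsB = Bounded-mono B≤m (Cls-bounded B)
    ClsAB = Cls-bounded AB

    fits-[_] : fsize X ≤ 2 * m → Fits m [ X ]
    fits-[ hX ] = fits-∷ hX (record { length-≤ = z≤n ; fsize-≤ = [] })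

    fits-P∷[_] : fsize X ≤ 2 * m → Fits m (P ∷ X ∷ [])
    fits-P∷[ hX ] = fits-∷ (s≤s z≤n) (Bounded-singleton (s≤s z≤n) hX)

    fits-[_]∷P : fsize X ≤ 2 * m → Fits m (X ∷ P ∷ [])
    fits-[ hX ]∷P = fits-∷ hX (Bounded-singleton (s≤s z≤n) (s≤s z≤n))

    conclude : Γ ⊩[ c · m ] Δ → {T (c ≤ᵇ 20)} → Fits m Γ → Fits m Δ →
               Γ ⊢[ poly 180 (dtsize A + dtsize B) ] Δ
    conclude = ⊩⇒⊢-poly (dtsize A + dtsize B)

  Tms⊢Cls : C ∈ Tms A → D ∈ Cls A → (C ∷ []) ⊢[ poly 180 (dtsize A + dtsize B) ] (D ∷ [])
  Tms⊢Cls C∈ D∈ = conclude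
    (⊩-rescale {b = 20} six-units (Tms⊩Cls A C∈ D∈))
    fits-[ fsize-∈ TmsA C∈ ] fits-[ fsize-∈ ClsA D∈ ]
    where
      six-units : 6 * dtsize A * 1 ≤ 20 * m
      six-units = ≤-trans (≤-reflexive (*-identityʳ _))
                          (*-mono-≤ (m≤m+n 6 14) A≤m)

  Cls-node⊢Cls-left : D ∈ Cls A → Cls AB ⊢[ poly 180 (dtsize A + dtsize B) ] (D ∷ P ∷ [])
  Cls-node⊢Cls-left D∈ = conclude
    (⊩-pickL (∈-Cls⁺ˡ A p B D∈) (length-≤ ClsAB)
      (⊩-∨L (⊩-weakR (⊩-ax p)) (⊩-swapR (⊩-weakR (⊩-id (fsize-∈ ClsA D∈))))))
    (fits ClsAB) fits-[ fsize-∈ ClsA D∈ ]∷P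

  Cls-node⊢Cls-right : D ∈ Cls B → (P ∷ Cls AB) ⊢[ poly 180 (dtsize A + dtsize B) ] (D ∷ [])
  Cls-node⊢Cls-right D∈ = conclude
    (⊩-pickL (∈-Cls⁺ʳ A p B D∈) (length-≤ ClsAB)
      (⊩-∨L (⊩-swapL (⊩-weakR (⊩-axL p))) (⊩-swapL (⊩-weakL (⊩-id (fsize-∈ ClsB D∈))))))
    (fits-∷ (s≤s z≤n) ClsAB) fits-[ fsize-∈ ClsB D∈ ]

  Cls-left⊢Cls-node : D ∈ Cls AB → Cls A ⊢[ poly 180 (dtsize A + dtsize B) ] (D ∷ P ∷ [])
  Cls-left⊢Cls-node D∈ = conclude (derive (Cls-view A p B D∈))
    (fits ClsA) fits-[ fsize-∈ ClsAB D∈ ]∷P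
    where
      derive : ClsView A p B D → Cls A ⊩[ 20 · m ] D ∷ P ∷ []
      derive (left D'∈) = ⊩-relax $ ⊩-∨R (⊩-pickL D'∈ (length-≤ ClsA)
        (⊩-exch ↭-refl (↭-prep P (↭-swap _ _ ↭-refl))
          (⊩-weakR (⊩-weakR (⊩-id (fsize-∈ ClsA D'∈))))))
      derive (right {D'} _) = ⊩-relax $ ⊩-∨R (⊩-extendL (Cls A) (length-≤ ClsA)
          (⊩-exch ↭-refl (shift N (D' ∷ P ∷ []) []) (⊩-weakR (⊩-axR p))))

  Cls-right⊢Cls-node : D ∈ Cls AB → (P ∷ Cls B) ⊢[ poly 180 (dtsize A + dtsize B) ] (D ∷ [])
  Cls-right⊢Cls-node D∈ = conclude (derive (Cls-view A p B D∈))
    (fits-∷ (s≤s z≤n) ClsB) fits-[ fsize-∈ ClsAB D∈ ]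
    where
      derive : ClsView A p B D → P ∷ Cls B ⊩[ 20 · m ] D ∷ []
      derive (left _) = ⊩-relax $ ⊩-∨R (⊩-extendL (Cls B) (length-≤ ClsB)
        (⊩-swapR (⊩-weakR (⊩-ax p))))
      derive (right D'∈) = ⊩-relax $ ⊩-∨R (⊩-pickL D'∈ (length-≤ ClsB)
        (⊩-swapL (⊩-weakL (⊩-weakR (⊩-id (fsize-∈ ClsB D'∈))))))

  Tms-left⊢Tms-node : C ∈ Tms A → (C ∷ []) ⊢[ poly 180 (dtsize A + dtsize B) ] (P ∷ Tms AB)
  Tms-left⊢Tms-node C∈ = conclude
    (⊩-pickR (∈-Tms⁺ˡ A p B C∈) (length-≤ TmsAB)
      (⊩-∧R (⊩-weakL (⊩-swapR (⊩-axR p))) (⊩-swapR (⊩-weakR (⊩-id (fsize-∈ TmsA C∈))))))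
    fits-[ fsize-∈ TmsA C∈ ] (fits-∷ (s≤s z≤n) TmsAB)

  Tms-right⊢Tms-node : C ∈ Tms B → (P ∷ C ∷ []) ⊢[ poly 180 (dtsize A + dtsize B) ] Tms AB
  Tms-right⊢Tms-node C∈ = conclude
    (⊩-pickR (∈-Tms⁺ʳ A p B C∈) (length-≤ TmsAB)
      (⊩-∧R (⊩-swapL (⊩-weakL (⊩-ax p))) (⊩-weakL (⊩-id (fsize-∈ TmsB C∈)))))
    fits-P∷[ fsize-∈ TmsB C∈ ] (fits TmsAB)

  Tms-node⊢Tms-left : C ∈ Tms AB → (C ∷ []) ⊢[ poly 180 (dtsize A + dtsize B) ] (P ∷ Tms A)
  Tms-node⊢Tms-left C∈ = conclude (derive (Tms-view A p B C∈))
    fits-[ fsize-∈ TmsAB C∈ ] (fits-∷ (s≤s z≤n) TmsA)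
    where
      derive : TmsView A p B C → C ∷ [] ⊩[ 20 · m ] P ∷ Tms A
      derive (left C'∈) = ⊩-relax $ ⊩-∧L (⊩-pickR C'∈ (length-≤ TmsA)
        (⊩-swapR (⊩-weakL (⊩-weakR (⊩-id (fsize-∈ TmsA C'∈))))))
      derive (right _) = ⊩-relax $ ⊩-∧L (⊩-extendR (Tms A) (length-≤ TmsA)
        (⊩-swapL (⊩-weakL (⊩-ax p))))

  Tms-node⊢Tms-right : C ∈ Tms AB → (P ∷ C ∷ []) ⊢[ poly 180 (dtsize A + dtsize B) ] Tms B
  Tms-node⊢Tms-right C∈ = conclude (⊩-swapL (derive (Tms-view A p B C∈)))
    fits-P∷[ fsize-∈ TmsAB C∈ ] (fits TmsB)
    where
      derive : TmsView A p B C → C ∷ P ∷ [] ⊩[ 19 · m ] Tms B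
      derive (left {C'} _) = ⊩-relax $ ⊩-∧L (⊩-extendR (Tms B) (length-≤ TmsB)
        (⊩-exch (shift N (C' ∷ P ∷ []) []) ↭-refl (⊩-weakL (⊩-axL p))))
      derive (right C'∈) = ⊩-relax $ ⊩-∧L (⊩-pickR C'∈ (length-≤ TmsB)
        (⊩-exch (↭-prep P (↭-swap _ _ ↭-refl)) ↭-refl
          (⊩-weakL (⊩-weakL (⊩-id (fsize-∈ TmsB C'∈))))))

proposition3p6 : Σ ℕ λ c → (A B : DT) (p : Literal) →
  let N  = poly c (dtsize A + dtsize B)
      AB = node A p B
  in
  -- (a)
  (∀ {C D} → C ∈ Tms A → D ∈ Cls A → (C ∷ []) ⊢[ N ] (D ∷ []))
  -- (b)(i)
  × (∀ {D} → D ∈ Cls A → Cls AB ⊢[ N ] (D ∷ ⟨ p ⟩ ∷ []))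
  -- (b)(ii)
  × (∀ {D} → D ∈ Cls B → (⟨ p ⟩ ∷ Cls AB) ⊢[ N ] (D ∷ []))
  -- (b)(iii)
  × (∀ {D} → D ∈ Cls AB → Cls A ⊢[ N ] (D ∷ ⟨ p ⟩ ∷ []))
  -- (b)(iv)
  × (∀ {D} → D ∈ Cls AB → (⟨ p ⟩ ∷ Cls B) ⊢[ N ] (D ∷ []))
  -- (c)(i)
  × (∀ {C} → C ∈ Tms A → (C ∷ []) ⊢[ N ] (⟨ p ⟩ ∷ Tms AB))
  -- (c)(ii)
  × (∀ {C} → C ∈ Tms B → (⟨ p ⟩ ∷ C ∷ []) ⊢[ N ] Tms AB)
  -- (c)(iii)
  × (∀ {C} → C ∈ Tms AB → (C ∷ []) ⊢[ N ] (⟨ p ⟩ ∷ Tms A))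
  -- (c)(iv)
  × (∀ {C} → C ∈ Tms AB → (⟨ p ⟩ ∷ C ∷ []) ⊢[ N ] Tms B)
proposition3p6 = 180 , λ A B p →
    Tms⊢Cls A B p
  , Cls-node⊢Cls-left A B p , Cls-node⊢Cls-right A B p
  , Cls-left⊢Cls-node A B p , Cls-right⊢Cls-node A B p
  , Tms-left⊢Tms-node A B p , Tms-right⊢Tms-node A B p
  , Tms-node⊢Tms-left A B p , Tms-node⊢Tms-right A B p
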